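{- Let $G$ be a connected non-bipartite graph with diameter $D$, and let $(\mathcal{W}_t)_{t\ge0}$ be a round-fair process on $G$. If at time step $t$ the distribution $\mathcal{W}_t$ has discrepancy over arcs equal to $x$ with $x>4D+1$, then $$\Phi(\mathcal{W}_t)-\Phi(\mathcal{W}_{t+1})\ge\frac{(x-4D-1)(x-1)}{4D}.$$
   Context: $G=(V,E)$ is a finite connected undirected graph; $\vec G=(V,\vec E)$ replaces each edge $\{u,v\}$ by arcs $(u,v),(v,u)$; $\mathrm{in}(v),\mathrm{out}(v)$ denote the incoming/outgoing arcs of $v$ and $\deg(v)=|\mathrm{out}(v)|$. A round-fair process is a sequence $(\mathcal{W}_t)_{t\ge 0}$ of functions $\mathcal{W}_t:V\cup\vec E\to\mathbb{Z}_{\ge0}$ (token distributions) such that for all $t$ and $v$: $\mathcal{W}_t(v)=\sum_{e\in\mathrm{out}(v)}\mathcal{W}_t(e)$; every $e\in\mathrm{out}(v)$ has $\mathcal{W}_t(e)\in\{\lfloor \mathcal{W}_t(v)/\deg(v)\rfloor,\lceil \mathcal{W}_t(v)/\deg(v)\rceil\}$; and tokens sent along arcs arrive at their heads, $\mathcal{W}_{t+1}(v)=\sum_{e\in\mathrm{in}(v)}\mathcal{W}_t(e)$. The potential is $\Phi(\mathcal{W}_t)=\sum_{e\in\vec E}(\mathcal{W}_t(e))^2$, and the discrepancy over arcs of $\mathcal{W}_t$ is $\max_{e,e'\in\vec E}(\mathcal{W}_t(e)-\mathcal{W}_t(e'))$. -}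

module Defs where

open import Data.Nat using (ℕ; zero; suc; _+_; _*_; _∸_; _/_; _≤_; _<_)
open import Data.Fin using (Fin)
open import Data.Bool using (Bool; true; false; if_then_else_)
open import Data.List using (List; map; allFin)
open import Data.Nat.ListAction using (sum)
open import Data.Product using (Σ; ∃; _×_; _,_)
open import Data.Sum using (_⊎_)
open import Relation.Binary.PropositionalEquality using (_≡_; _≢_)
open import Relation.Nullary using (¬_)

record Graph (n : ℕ) : Set where
  field
    adj   : Fin n → Fin n → Bool
    sym   : ∀ u v → adj u v ≡ adj v u
    irrefl : ∀ u → adj u u ≡ false
open Graph public

Σv : ∀ {n} → (Fin n → ℕ) → ℕ
Σv {n} f = sum (map f (allFin n))

ind : Bool → ℕ
ind b = if b then 1 else 0

-- Arc (u,v) of the directed version exists iff adj u v ≡ true.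
-- deg v = |out(v)|
deg : ∀ {n} → Graph n → Fin n → ℕ
deg G v = Σv (λ u → ind (adj G v u))

-- floor and ceiling of a / d (only used with d ≥ 1)
floorDiv : ℕ → ℕ → ℕ
floorDiv a zero = 0
floorDiv a (suc k) = a / suc k

ceilDiv : ℕ → ℕ → ℕ
ceilDiv a zero = 0
ceilDiv a (suc k) = (a + k) / suc k

data Walk {n} (G : Graph n) : Fin n → Fin n → ℕ → Set where
  here : ∀ {u} → Walk G u u 0
  step : ∀ {u w v k} → adj G u w ≡ true → Walk G w v k → Walk G u v (suc k)

Connected : ∀ {n} → Graph n → Set
Connected G = ∀ u v → ∃ λ k → Walk G u v k

IsDiameter : ∀ {n} → Graph n → ℕ → Set
IsDiameter G D =
  (∀ u v → ∃ λ k → k ≤ D × Walk G u v k) ×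
  (∃ λ u → ∃ λ v → ∀ k → Walk G u v k → D ≤ k)

Bipartite : ∀ {n} → Graph n → Set
Bipartite {n} G = ∃ λ (c : Fin n → Bool) → ∀ u v → adj G u v ≡ true → c u ≢ c v

-- A sequence of token distributions: vertex loads and arc loads
-- (arc loads W t u v are only meaningful when adj G u v ≡ true).
VertexLoads : ℕ → Set
VertexLoads n = ℕ → Fin n → ℕ

ArcLoads : ℕ → Set
ArcLoads n = ℕ → Fin n → Fin n → ℕ

record RoundFair {n} (G : Graph n) (Wv : VertexLoads n) (We : ArcLoads n) : Set where
  field
    split   : ∀ t v → Wv t v ≡ Σv (λ u → ind (adj G v u) * We t v u)
    fair    : ∀ t v u → adj G v u ≡ true →
              (We t v u ≡ floorDiv (Wv t v) (deg G v)) ⊎ (We t v u ≡ ceilDiv (Wv t v) (deg G v))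
    arrive  : ∀ t v → Wv (suc t) v ≡ Σv (λ u → ind (adj G u v) * We t u v)

Φ : ∀ {n} → Graph n → ArcLoads n → ℕ → ℕ
Φ G We t = Σv (λ u → Σv (λ v → ind (adj G u v) * (We t u v * We t u v)))

ArcDiscrepancy : ∀ {n} → Graph n → ArcLoads n → ℕ → ℕ → Set
ArcDiscrepancy G We t x =
  (∀ u v u' v' → adj G u v ≡ true → adj G u' v' ≡ true → We t u v ≤ We t u' v' + x) ×
  (∃ λ u → ∃ λ v → ∃ λ u' → ∃ λ v' →
     adj G u v ≡ true × adj G u' v' ≡ true × We t u v ≡ We t u' v' + x)

-- Split the potential change vertex by vertex.  A vertex m sends q or q + 1 along each of its arcs,
-- has as many in- as out-arcs and sends exactly what it received; hence
-- Σ_in w² − Σ_out (sent)² = Σ_in (w − q)(w − q − 1), the "arrival imbalance", is m's share of the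
-- drop, and any two loads α, β arriving at m satisfy (α − β)² ≤ 2·share + 1.  As G is not bipartite,
-- the tails of a heaviest and a lightest arc are joined by an even walk of length at most 4D, i.e.
-- a zigzag u₀ → m₁ ← u₁ → ⋯ ← u_k with k ≤ 2D steps and distinct midpoints.  Along it the arc load
-- changes by at most 1 at each uᵢ (round-fairness) and by |α − β| at each mᵢ, so the discrepancy x
-- is at most k + 1 + Σ|α − β|, and Cauchy–Schwarz gives 2k·drop ≥ (x − 1)(x − 2k − 1).

module Submission where

open import Data.Nat hiding (_≟_)
open import Data.Nat.Properties hiding (_≟_)
open import Data.Nat.DivMod using (/-monoˡ-≤; +-distrib-/-∣ʳ; n/n≡1)
open import Data.Nat.Divisibility using (∣-refl)
open import Data.Nat.ListAction using (sum)
open import Data.Nat.Tactic.RingSolver using (solve-∀)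
open import Data.Parity.Base using (0ℙ; 1ℙ) renaming (_+_ to _+ℙ_)
open import Data.Parity.Properties using (+-homo-+; p+p≡0ℙ) renaming (_≟_ to _≟ℙ_)
open import Data.Fin using (Fin; zero; suc)
open import Data.Fin.Properties using (_≟_; any?)
open import Data.Bool using (Bool; true; false; if_then_else_)
import Data.Bool.Properties as B
open import Data.List using (List; []; _∷_; map; tabulate; length)
open import Data.List.Properties using (map-tabulate)
open import Data.List.Relation.Unary.All using (All; []; _∷_)
open import Data.List.Relation.Unary.AllPairs using ([]; _∷_)
open import Data.List.Relation.Unary.Unique.Propositional using (Unique)
open import Data.Product using (Σ; ∃; _×_; _,_; proj₁; proj₂)
open import Data.Sum using (_⊎_; inj₁; inj₂)
open import Function using (_∘_)
open import Relation.Binary.PropositionalEquality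
open import Relation.Binary.Consequences using (wlog)
open import Relation.Nullary using (¬_; does; yes; no; contradiction; _×-dec_)
open import Defs hiding (sym)
open import Algebra.Properties.Semiring.Sum +-*-semiring
  using (∑-distrib-+; ∑-comm; *-distribˡ-sum; sum-cong-≗; sum-replicate-zero)
  renaming (sum to ∑)

Σv≡∑ : ∀ {n} (f : Fin n → ℕ) → Σv f ≡ ∑ f
Σv≡∑ f = trans (cong sum (map-tabulate (λ i → i) f)) (sum-tabulate f)
  where
  sum-tabulate : ∀ {n} (f : Fin n → ℕ) → sum (tabulate f) ≡ ∑ f
  sum-tabulate {zero} f = refl
  sum-tabulate {suc n} f = cong (f zero +_) (sum-tabulate (f ∘ suc))

erase : ∀ {n} → Fin n → (Fin n → ℕ) → Fin n → ℕ
erase a h i = if does (i ≟ a) then 0 else h i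

∑-erase : ∀ {n} (a : Fin n) (h : Fin n → ℕ) → ∑ h ≡ h a + ∑ (erase a h)
∑-erase zero h = refl
∑-erase (suc a) h = begin
  h zero + ∑ (h ∘ suc)                        ≡⟨ cong (h zero +_) (∑-erase a (h ∘ suc)) ⟩
  h zero + (h (suc a) + ∑ (erase a (h ∘ suc))) ≡⟨ x+[y+z]≡y+[x+z] (h zero) (h (suc a)) _ ⟩
  h (suc a) + (h zero + ∑ (erase a (h ∘ suc))) ∎
  where
  open ≡-Reasoning
  x+[y+z]≡y+[x+z] : ∀ x y z → x + (y + z) ≡ y + (x + z)
  x+[y+z]≡y+[x+z] = solve-∀

erase-≢ : ∀ {n} {a i : Fin n} (h : Fin n → ℕ) → a ≢ i → erase a h i ≡ h i
erase-≢ {a = a} {i} h a≢i with i ≟ a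
... | yes refl = contradiction refl a≢i
... | no _ = refl

sum-unique≤∑ : ∀ {n} (h : Fin n → ℕ) {l : List (Fin n)} → Unique l → sum (map h l) ≤ ∑ h
sum-unique≤∑ h [] = z≤n
sum-unique≤∑ h {a ∷ l} (a∉l ∷ unique) = begin
  h a + sum (map h l)           ≡⟨ cong (h a +_) (sum-map-erase a∉l) ⟨
  h a + sum (map (erase a h) l) ≤⟨ +-monoʳ-≤ (h a) (sum-unique≤∑ (erase a h) unique) ⟩
  h a + ∑ (erase a h)           ≡⟨ ∑-erase a h ⟨
  ∑ h                           ∎
  where
  open ≤-Reasoning
  sum-map-erase : ∀ {l} → All (a ≢_) l → sum (map (erase a h) l) ≡ sum (map h l)
  sum-map-erase [] = refl
  sum-map-erase (a≢i ∷ a∉l) = cong₂ _+_ (erase-≢ h a≢i) (sum-map-erase a∉l)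

-- Arithmetic of imbalances

2*mn≤m²+n² : ∀ m n → 2 * (m * n) ≤ m * m + n * n
2*mn≤m²+n² = wlog {Q = λ m n → 2 * (m * n) ≤ m * m + n * n} ≤-total (λ {m n} → symmetric m n) from-≤
  where
  symmetric : ∀ m n → 2 * (m * n) ≤ m * m + n * n → 2 * (n * m) ≤ n * n + m * m
  symmetric m n = subst₂ _≤_ (cong (2 *_) (*-comm m n)) (+-comm (m * m) (n * n))
  from-≤ : ∀ m n → m ≤ n → 2 * (m * n) ≤ m * m + n * n
  from-≤ m n m≤n with (r , refl) ← m≤n⇒∃[o]m+o≡n m≤n =
    subst (2 * (m * (m + r)) ≤_) (square-gap m r) (m≤m+n _ (r * r))
    where
    square-gap : ∀ m r → 2 * (m * (m + r)) + r * r ≡ m * m + (m + r) * (m + r)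
    square-gap = solve-∀

[m+n]²≤2[m²+n²] : ∀ m n → (m + n) * (m + n) ≤ 2 * (m * m + n * n)
[m+n]²≤2[m²+n²] m n = subst₂ _≤_ (expand m n) (double m n) (+-monoʳ-≤ (m * m + n * n) (2*mn≤m²+n² m n))
  where
  expand : ∀ m n → m * m + n * n + 2 * (m * n) ≡ (m + n) * (m + n)
  expand = solve-∀
  double : ∀ m n → m * m + n * n + (m * m + n * n) ≡ 2 * (m * m + n * n)
  double = solve-∀

cauchy-schwarz : ∀ ys → sum ys * sum ys ≤ length ys * sum (map (λ y → y * y) ys)
cauchy-schwarz [] = z≤n
-- The singleton case is split off so that length ys is nonzero in the step, where it is cancelled.
cauchy-schwarz (y ∷ []) = ≤-reflexive (single y)
  where
  single : ∀ y → (y + 0) * (y + 0) ≡ (y * y + 0) + 0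
  single = solve-∀
cauchy-schwarz (y ∷ ys@(_ ∷ _)) with IH ← cauchy-schwarz ys = begin
  (y + S) * (y + S)                 ≡⟨ expand y S ⟩
  y * y + 2 * (y * S) + S * S       ≤⟨ +-mono-≤ (+-monoʳ-≤ (y * y) cross) IH ⟩
  y * y + (Q + k * (y * y)) + k * Q ≡⟨ collect y Q k ⟩
  suc k * (y * y + Q)               ∎
  where
  open ≤-Reasoning
  S = sum ys
  Q = sum (map (λ y → y * y) ys)
  k = length ys
  cross : 2 * (y * S) ≤ Q + k * (y * y)
  cross = *-cancelˡ-≤ k (begin
    k * (2 * (y * S))         ≡⟨ shift k y S ⟩
    2 * ((k * y) * S)         ≤⟨ 2*mn≤m²+n² (k * y) S ⟩
    (k * y) * (k * y) + S * S ≤⟨ +-monoʳ-≤ ((k * y) * (k * y)) IH ⟩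
    (k * y) * (k * y) + k * Q ≡⟨ factor k y Q ⟩
    k * (Q + k * (y * y))     ∎)
    where
    shift : ∀ k y S → k * (2 * (y * S)) ≡ 2 * ((k * y) * S)
    shift = solve-∀
    factor : ∀ k y Q → (k * y) * (k * y) + k * Q ≡ k * (Q + k * (y * y))
    factor = solve-∀
  expand : ∀ y S → (y + S) * (y + S) ≡ y * y + 2 * (y * S) + S * S
  expand = solve-∀
  collect : ∀ y Q k → y * y + (Q + k * (y * y)) + k * Q ≡ suc k * (y * y + Q)
  collect = solve-∀

m+m≤1+n+n⇒m≤n : ∀ {m n} → m + m ≤ suc (n + n) → m ≤ n
m+m≤1+n+n⇒m≤n {m} {n} m+m≤1+n+n = ≮⇒≥ λ n<m →
  1+n≰n (+-cancelˡ-≤ n _ _ (s≤s⁻¹ (≤-trans (+-mono-≤ n<m n<m) m+m≤1+n+n)))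

-- imbalance q a is (a − q)(a − q − 1): zero exactly for a ∈ {q, q + 1}, positive otherwise.
imbalance : ℕ → ℕ → ℕ
imbalance q a = ∣ a - q ∣ * ∣ a - suc q ∣

data Position : ℕ → ℕ → Set where
  below : ∀ a r → Position (a + r) a
  above : ∀ q r → Position q (suc (q + r))

position : ∀ q a → Position q a
position q a with ≤-<-connex a q
... | inj₁ a≤q with (r , refl) ← m≤n⇒∃[o]m+o≡n a≤q = below a r
... | inj₂ q<a with (r , refl) ← m≤n⇒∃[o]m+o≡n q<a = above q r

imbalance-below : ∀ a r → imbalance (a + r) a ≡ r * suc r
imbalance-below a r = cong₂ _*_ (∣m-m+n∣≡n a r)
  (trans (cong ∣ a -_∣ (sym (+-suc a r))) (∣m-m+n∣≡n a (suc r)))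

imbalance-above : ∀ q r → imbalance q (suc (q + r)) ≡ suc r * r
imbalance-above q r = cong₂ _*_
  (trans (∣-∣-comm (suc (q + r)) q) (trans (cong ∣ q -_∣ (sym (+-suc q r))) (∣m-m+n∣≡n q (suc r))))
  (trans (∣-∣-comm (q + r) q) (∣m-m+n∣≡n q r))

imbalance-zero : ∀ {q a} → a ≡ q ⊎ a ≡ suc q → imbalance q a ≡ 0
imbalance-zero {q} (inj₁ refl) = cong (_* ∣ q - suc q ∣) (∣n-n∣≡0 q)
imbalance-zero {q} (inj₂ refl) = trans (cong (∣ suc q - q ∣ *_) (∣n-n∣≡0 q)) (*-zeroʳ ∣ suc q - q ∣)

a²+q[q+1]≡imbalance+[2q+1]a : ∀ q a → a * a + q * suc q ≡ imbalance q a + suc (q + q) * a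
a²+q[q+1]≡imbalance+[2q+1]a q a with position q a
... | below a r = trans (expand a r) (cong (_+ suc ((a + r) + (a + r)) * a) (sym (imbalance-below a r)))
  where
  expand : ∀ a r → a * a + (a + r) * suc (a + r) ≡ r * suc r + suc ((a + r) + (a + r)) * a
  expand = solve-∀
... | above q r = trans (expand q r) (cong (_+ suc (q + q) * suc (q + r)) (sym (imbalance-above q r)))
  where
  expand : ∀ q r → suc (q + r) * suc (q + r) + q * suc q ≡ suc r * r + suc (q + q) * suc (q + r)
  expand = solve-∀

imbalance≡pronic∧∣2a-[2q+1]∣≡odd : ∀ q a →
  ∃ λ r → imbalance q a ≡ r * suc r × ∣ a + a - suc (q + q) ∣ ≡ suc (r + r)
imbalance≡pronic∧∣2a-[2q+1]∣≡odd q a with position q a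
... | below a r = r , imbalance-below a r ,
  trans (cong ∣ a + a -_∣ (lower a r)) (∣m-m+n∣≡n (a + a) (suc (r + r)))
  where
  lower : ∀ a r → suc ((a + r) + (a + r)) ≡ a + a + suc (r + r)
  lower = solve-∀
... | above q r = r , trans (imbalance-above q r) (*-comm (suc r) r) ,
  trans (cong ∣_- suc (q + q) ∣ (upper q r))
    (trans (∣-∣-comm (suc (q + q) + suc (r + r)) (suc (q + q))) (∣m-m+n∣≡n (suc (q + q)) (suc (r + r))))
  where
  upper : ∀ q r → suc (q + r) + suc (q + r) ≡ suc (q + q) + suc (r + r)
  upper = solve-∀

4*imbalance+1≡∣2a-[2q+1]∣² : ∀ q a →
  4 * imbalance q a + 1 ≡ ∣ a + a - suc (q + q) ∣ * ∣ a + a - suc (q + q) ∣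
4*imbalance+1≡∣2a-[2q+1]∣² q a with imbalance≡pronic∧∣2a-[2q+1]∣≡odd q a
... | r , imb , gap rewrite imb | gap = odd-square r
  where
  odd-square : ∀ r → 4 * (r * suc r) + 1 ≡ suc (r + r) * suc (r + r)
  odd-square = solve-∀

∣a-b∣²≤2[imbalance+imbalance]+1 : ∀ q a b →
  ∣ a - b ∣ * ∣ a - b ∣ ≤ 2 * (imbalance q a + imbalance q b) + 1
∣a-b∣²≤2[imbalance+imbalance]+1 q a b = *-cancelˡ-≤ 4 (begin
  4 * (d * d)                                       ≡⟨ quadruple d ⟩
  (2 * d) * (2 * d)                                 ≤⟨ *-mono-≤ 2d≤ga+gb 2d≤ga+gb ⟩
  (ga + gb) * (ga + gb)                             ≤⟨ [m+n]²≤2[m²+n²] ga gb ⟩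
  2 * (ga * ga + gb * gb)
    ≡⟨ cong₂ (λ u v → 2 * (u + v)) (4*imbalance+1≡∣2a-[2q+1]∣² q a) (4*imbalance+1≡∣2a-[2q+1]∣² q b) ⟨
  2 * ((4 * imbalance q a + 1) + (4 * imbalance q b + 1)) ≡⟨ regroup (imbalance q a) (imbalance q b) ⟩
  4 * (2 * (imbalance q a + imbalance q b) + 1)     ∎)
  where
  open ≤-Reasoning
  d = ∣ a - b ∣
  ga = ∣ a + a - suc (q + q) ∣
  gb = ∣ b + b - suc (q + q) ∣
  double : ∀ a → 2 * a ≡ a + a
  double = solve-∀
  2d≤ga+gb : 2 * d ≤ ga + gb
  2d≤ga+gb = begin
    2 * d                        ≡⟨ *-distribˡ-∣-∣ 2 a b ⟩
    ∣ 2 * a - 2 * b ∣            ≡⟨ cong₂ ∣_-_∣ (double a) (double b) ⟩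
    ∣ a + a - b + b ∣            ≤⟨ ∣-∣-triangle (a + a) (suc (q + q)) (b + b) ⟩
    ga + ∣ suc (q + q) - b + b ∣ ≡⟨ cong (ga +_) (∣-∣-comm (suc (q + q)) (b + b)) ⟩
    ga + gb                      ∎
  quadruple : ∀ d → 4 * (d * d) ≡ (2 * d) * (2 * d)
  quadruple = solve-∀
  regroup : ∀ i j → 2 * ((4 * i + 1) + (4 * j + 1)) ≡ 4 * (2 * (i + j) + 1)
  regroup = solve-∀

[k+r]²≤k[2Δ+k]⇒r[2k+r]≤k[2Δ] : ∀ k r Δ →
  (k + r) * (k + r) ≤ k * (2 * Δ + k) → r * (k + k + r) ≤ k * (2 * Δ)
[k+r]²≤k[2Δ+k]⇒r[2k+r]≤k[2Δ] k r Δ bound = +-cancelʳ-≤ (k * k) _ _ (begin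
  r * (k + k + r) + k * k ≡⟨ complete-square k r ⟩
  (k + r) * (k + r)       ≤⟨ bound ⟩
  k * (2 * Δ + k)         ≡⟨ *-distribˡ-+ k (2 * Δ) k ⟩
  k * (2 * Δ) + k * k     ∎)
  where
  open ≤-Reasoning
  complete-square : ∀ k r → r * (k + k + r) + k * k ≡ (k + r) * (k + r)
  complete-square = solve-∀

potential-drop-bound : ∀ D {k x} Y Δ → k ≤ 2 * D → 4 * D + 1 < x → x ≤ Y + suc k →
                       Y * Y ≤ k * (2 * Δ + k) → (x ∸ (4 * D + 1)) * (x ∸ 1) ≤ 4 * D * Δ
potential-drop-bound D {k} {suc p} Y Δ k≤2D (s≤s 4D+1≤p) x≤Y+1+k Y²≤k[2Δ+k]
  with ≤-trans (+-mono-≤ k≤2D k≤2D) (≤-reflexive (sym (*-distribʳ-+ D 2 2)))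
... | 2k≤4D with m≤n⇒∃[o]m+o≡n (≤-trans 2k≤4D (m+n≤o⇒m≤o (4 * D) 4D+1≤p))
... | r , refl = begin
  (suc (k + k + r) ∸ (4 * D + 1)) * (k + k + r) ≤⟨ *-monoˡ-≤ (k + k + r) x∸[4D+1]≤r ⟩
  r * (k + k + r)                               ≤⟨ [k+r]²≤k[2Δ+k]⇒r[2k+r]≤k[2Δ] k r Δ [k+r]²≤k[2Δ+k] ⟩
  k * (2 * Δ)                                   ≤⟨ *-monoˡ-≤ (2 * Δ) k≤2D ⟩
  2 * D * (2 * Δ)                               ≡⟨ regroup D Δ ⟩
  4 * D * Δ                                     ∎
  where
  open ≤-Reasoning
  x∸[4D+1]≤r : suc (k + k + r) ∸ (4 * D + 1) ≤ r
  x∸[4D+1]≤r = begin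
    suc (k + k + r) ∸ (4 * D + 1)
      ≤⟨ ∸-monoʳ-≤ (suc (k + k + r)) (subst (suc (k + k) ≤_) (+-comm 1 (4 * D)) (s≤s 2k≤4D)) ⟩
    suc (k + k + r) ∸ suc (k + k) ≡⟨ m+n∸m≡n (k + k) r ⟩
    r                             ∎
  [k+r]²≤k[2Δ+k] : (k + r) * (k + r) ≤ k * (2 * Δ + k)
  [k+r]²≤k[2Δ+k] = ≤-trans (*-mono-≤ k+r≤Y k+r≤Y) Y²≤k[2Δ+k]
    where
    k+r≤Y : k + r ≤ Y
    k+r≤Y = +-cancelʳ-≤ (suc k) _ _ (subst (_≤ Y + suc k) (shuffle k r) x≤Y+1+k)
      where
      shuffle : ∀ k r → suc (k + k + r) ≡ k + r + suc k
      shuffle = solve-∀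
  regroup : ∀ D Δ → 2 * D * (2 * Δ) ≡ 4 * D * Δ
  regroup = solve-∀

-- The potential drop of one round

ceilDiv≡floorDiv⊎1+floorDiv : ∀ L d → ceilDiv L d ≡ floorDiv L d ⊎ ceilDiv L d ≡ suc (floorDiv L d)
ceilDiv≡floorDiv⊎1+floorDiv L zero = inj₁ refl
ceilDiv≡floorDiv⊎1+floorDiv L (suc k) with m≤n⇒m<n∨m≡n ceil≤1+floor
  where
  open ≤-Reasoning
  ceil≤1+floor : (L + k) / suc k ≤ suc (L / suc k)
  ceil≤1+floor = begin
    (L + k) / suc k     ≤⟨ /-monoˡ-≤ (suc k) (+-monoʳ-≤ L (n≤1+n k)) ⟩
    (L + suc k) / suc k ≡⟨ +-distrib-/-∣ʳ L ∣-refl ⟩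
    L / suc k + suc k / suc k ≡⟨ cong (L / suc k +_) (n/n≡1 (suc k)) ⟩
    L / suc k + 1       ≡⟨ +-comm (L / suc k) 1 ⟩
    suc (L / suc k)     ∎
... | inj₁ ceil≤floor = inj₁ (≤-antisym (s≤s⁻¹ ceil≤floor) (/-monoˡ-≤ (suc k) (m≤m+n L k)))
... | inj₂ ceil≡1+floor = inj₂ ceil≡1+floor

∑-square-decomposition : ∀ {n} q (s a : Fin n → ℕ) →
  ∑ (λ i → s i * (a i * a i)) + q * suc q * ∑ s ≡
  ∑ (λ i → s i * imbalance q (a i)) + suc (q + q) * ∑ (λ i → s i * a i)
∑-square-decomposition q s a = begin
  ∑ (λ i → s i * (a i * a i)) + q * suc q * ∑ s
    ≡⟨ cong (∑ (λ i → s i * (a i * a i)) +_) (*-distribˡ-sum (q * suc q) s) ⟩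
  ∑ (λ i → s i * (a i * a i)) + ∑ (λ i → q * suc q * s i)
    ≡⟨ ∑-distrib-+ (λ i → s i * (a i * a i)) (λ i → q * suc q * s i) ⟨
  ∑ (λ i → s i * (a i * a i) + q * suc q * s i)
    ≡⟨ sum-cong-≗ (λ i → pointwise (s i) (a i)) ⟩
  ∑ (λ i → s i * imbalance q (a i) + suc (q + q) * (s i * a i))
    ≡⟨ ∑-distrib-+ (λ i → s i * imbalance q (a i)) (λ i → suc (q + q) * (s i * a i)) ⟩
  ∑ (λ i → s i * imbalance q (a i)) + ∑ (λ i → suc (q + q) * (s i * a i))
    ≡⟨ cong (∑ (λ i → s i * imbalance q (a i)) +_) (*-distribˡ-sum (suc (q + q)) (λ i → s i * a i)) ⟨
  ∑ (λ i → s i * imbalance q (a i)) + suc (q + q) * ∑ (λ i → s i * a i) ∎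
  where
  open ≡-Reasoning
  pointwise : ∀ s a → s * (a * a) + q * suc q * s ≡ s * imbalance q a + suc (q + q) * (s * a)
  pointwise s a = begin
    s * (a * a) + q * suc q * s             ≡⟨ factor s (a * a) (q * suc q) ⟩
    s * (a * a + q * suc q)                 ≡⟨ cong (s *_) (a²+q[q+1]≡imbalance+[2q+1]a q a) ⟩
    s * (imbalance q a + suc (q + q) * a)   ≡⟨ expand s (imbalance q a) (suc (q + q)) a ⟩
    s * imbalance q a + suc (q + q) * (s * a) ∎
    where
    factor : ∀ s x y → s * x + y * s ≡ s * (x + y)
    factor = solve-∀
    expand : ∀ s x y a → s * (x + y * a) ≡ s * x + y * (s * a)
    expand = solve-∀

≡q⊎≡1+q⇒≤+1 : ∀ {q a b} → a ≡ q ⊎ a ≡ suc q → b ≡ q ⊎ b ≡ suc q → a ≤ b + 1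
≡q⊎≡1+q⇒≤+1 {q} (inj₁ refl) (inj₁ refl) = m≤m+n q 1
≡q⊎≡1+q⇒≤+1 {q} (inj₁ refl) (inj₂ refl) = ≤-trans (n≤1+n q) (m≤m+n (suc q) 1)
≡q⊎≡1+q⇒≤+1 {q} (inj₂ refl) (inj₁ refl) = ≤-reflexive (+-comm 1 q)
≡q⊎≡1+q⇒≤+1 {q} (inj₂ refl) (inj₂ refl) = m≤m+n (suc q) 1

fairShare : ∀ {n} → Graph n → VertexLoads n → ℕ → Fin n → ℕ
fairShare G Wv t v = floorDiv (Wv t v) (deg G v)

-- With w the arc loads at time t and q m the share m sends at time t + 1, this is m's contribution
-- to the potential drop.
arrivalImbalance : ∀ {n} → Graph n → (Fin n → Fin n → ℕ) → (Fin n → ℕ) → Fin n → ℕ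
arrivalImbalance G w q m = ∑ (λ u → ind (adj G u m) * imbalance (q m) (w u m))

module _ {n} {G : Graph n} {Wv : VertexLoads n} {We : ArcLoads n} (rf : RoundFair G Wv We) where
  open RoundFair rf

  sent-load∈ : ∀ t {v u} → adj G v u ≡ true →
               We t v u ≡ fairShare G Wv t v ⊎ We t v u ≡ suc (fairShare G Wv t v)
  sent-load∈ t {v} {u} v→u with fair t v u v→u | ceilDiv≡floorDiv⊎1+floorDiv (Wv t v) (deg G v)
  ... | inj₁ floor | _                 = inj₁ floor
  ... | inj₂ ceil  | inj₁ ceil≡floor   = inj₁ (trans ceil ceil≡floor)
  ... | inj₂ ceil  | inj₂ ceil≡1+floor = inj₂ (trans ceil ceil≡1+floor)

  sent-loads-balanced : ∀ t {a v v'} → adj G a v ≡ true → adj G a v' ≡ true → We t a v ≤ We t a v' + 1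
  sent-loads-balanced t a→v a→v' = ≡q⊎≡1+q⇒≤+1 (sent-load∈ t a→v) (sent-load∈ t a→v')

  arriving²≡sent²+arrivalImbalance : ∀ t m →
    ∑ (λ u → ind (adj G u m) * (We t u m * We t u m)) ≡
    ∑ (λ u → ind (adj G m u) * (We (suc t) m u * We (suc t) m u)) +
    arrivalImbalance G (We t) (fairShare G Wv (suc t)) m
  arriving²≡sent²+arrivalImbalance t m = +-cancelʳ-≡ (Q * ∑ out) _ _ (begin
    In + Q * ∑ out                   ≡⟨ cong (λ d → In + Q * d) (sum-cong-≗ in≗out) ⟨
    In + Q * ∑ in'                   ≡⟨ ∑-square-decomposition q in' (λ u → We t u m) ⟩
    Δ + K * ∑ (λ u → in' u * We t u m) ≡⟨ cong (λ L → Δ + K * L) received≡sent ⟩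
    Δ + K * ∑ (λ u → out u * We (suc t) m u)
      ≡⟨ cong (λ z → Δ + (z + K * ∑ (λ u → out u * We (suc t) m u))) sent-imbalance≡0 ⟨
    Δ + (∑ (λ u → out u * imbalance q (We (suc t) m u)) + K * ∑ (λ u → out u * We (suc t) m u))
      ≡⟨ cong (Δ +_) (∑-square-decomposition q out (We (suc t) m)) ⟨
    Δ + (Out + Q * ∑ out)            ≡⟨ shuffle Δ Out (Q * ∑ out) ⟩
    Out + Δ + Q * ∑ out              ∎)
    where
    open ≡-Reasoning
    q = fairShare G Wv (suc t) m
    Q = q * suc q
    K = suc (q + q)
    in' out : Fin n → ℕ
    in' u = ind (adj G u m)
    out u = ind (adj G m u)
    In = ∑ (λ u → in' u * (We t u m * We t u m))
    Out = ∑ (λ u → out u * (We (suc t) m u * We (suc t) m u))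
    Δ = arrivalImbalance G (We t) (fairShare G Wv (suc t)) m
    in≗out : ∀ u → in' u ≡ out u
    in≗out u = cong ind (Graph.sym G u m)
    received≡sent : ∑ (λ u → in' u * We t u m) ≡ ∑ (λ u → out u * We (suc t) m u)
    received≡sent = begin
      ∑ (λ u → in' u * We t u m)        ≡⟨ Σv≡∑ (λ u → in' u * We t u m) ⟨
      Σv (λ u → in' u * We t u m)       ≡⟨ arrive t m ⟨
      Wv (suc t) m                      ≡⟨ split (suc t) m ⟩
      Σv (λ u → out u * We (suc t) m u) ≡⟨ Σv≡∑ (λ u → out u * We (suc t) m u) ⟩
      ∑ (λ u → out u * We (suc t) m u)  ∎
    sent-imbalance≡0 : ∑ (λ u → out u * imbalance q (We (suc t) m u)) ≡ 0
    sent-imbalance≡0 = trans (sum-cong-≗ vanishes) (sum-replicate-zero n)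
      where
      vanishes : ∀ u → out u * imbalance q (We (suc t) m u) ≡ 0
      vanishes u with adj G m u in m→u
      ... | false = refl
      ... | true  = trans (+-identityʳ _) (imbalance-zero (sent-load∈ (suc t) m→u))
    shuffle : ∀ a b c → a + (b + c) ≡ b + a + c
    shuffle = solve-∀

  Φ-step : ∀ t → Φ G We t ≡ Φ G We (suc t) + ∑ (arrivalImbalance G (We t) (fairShare G Wv (suc t)))
  Φ-step t = begin
    Φ G We t                          ≡⟨ Σv²≡∑² (F t) ⟩
    ∑ (λ u → ∑ (λ v → F t u v))       ≡⟨ ∑-comm (F t) ⟩
    ∑ (λ v → ∑ (λ u → F t u v))       ≡⟨ sum-cong-≗ (arriving²≡sent²+arrivalImbalance t) ⟩
    ∑ (λ v → ∑ (F (suc t) v) + Δ v)   ≡⟨ ∑-distrib-+ (λ v → ∑ (F (suc t) v)) Δ ⟩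
    ∑ (λ v → ∑ (F (suc t) v)) + ∑ Δ   ≡⟨ cong (_+ ∑ Δ) (Σv²≡∑² (F (suc t))) ⟨
    Φ G We (suc t) + ∑ Δ              ∎
    where
    open ≡-Reasoning
    F : ℕ → Fin n → Fin n → ℕ
    F s u v = ind (adj G u v) * (We s u v * We s u v)
    Δ = arrivalImbalance G (We t) (fairShare G Wv (suc t))
    Σv²≡∑² : (F : Fin n → Fin n → ℕ) → Σv (λ u → Σv (F u)) ≡ ∑ (λ u → ∑ (F u))
    Σv²≡∑² F = trans (Σv≡∑ (λ u → Σv (F u))) (sum-cong-≗ (λ u → Σv≡∑ (F u)))

-- Zigzags

parity[i+1+j]≡1ℙ : ∀ i j → parity i ≡ parity j → parity (i + suc j) ≡ 1ℙ
parity[i+1+j]≡1ℙ i j same rewrite +-homo-+ i (suc j) | +-homo-+ 1 j | same with parity j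
... | 0ℙ = refl
... | 1ℙ = refl

parity[i+j]≡0ℙ : ∀ i j → parity i ≡ 1ℙ → parity j ≡ 1ℙ → parity (i + j) ≡ 0ℙ
parity[i+j]≡0ℙ i j odd-i odd-j rewrite +-homo-+ i j | odd-i | odd-j = refl

parity[1+s+s]≡1ℙ : ∀ s → parity (suc (s + s)) ≡ 1ℙ
parity[1+s+s]≡1ℙ s = trans (+-homo-+ 1 (s + s)) (cong (1ℙ +ℙ_) (trans (+-homo-+ s s) (p+p≡0ℙ (parity s))))

adj-sym : ∀ {n} (G : Graph n) {u v} → adj G u v ≡ true → adj G v u ≡ true
adj-sym G {u} {v} u→v = trans (Graph.sym G v u) u→v

module _ {n} {G : Graph n} where

  walk-snoc : ∀ {u v w k} → Walk G u v k → adj G v w ≡ true → Walk G u w (suc k)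
  walk-snoc here v→w = step v→w here
  walk-snoc (step u→x p) v→w = step u→x (walk-snoc p v→w)

  walk-reverse : ∀ {u v k} → Walk G u v k → Walk G v u k
  walk-reverse here = here
  walk-reverse (step u→x p) = walk-snoc (walk-reverse p) (adj-sym G u→x)

  walk-++ : ∀ {u v w j k} → Walk G u v j → Walk G v w k → Walk G u w (j + k)
  walk-++ here q = q
  walk-++ (step u→x p) q = step u→x (walk-++ p q)

-- A walk a₀ → m₁ ← a₁ → m₂ ← ⋯ → m_k ← a_k: consecutive a's send load into a common midpoint.
data Zigzag {n} (G : Graph n) : Fin n → Fin n → ℕ → Set where
  []  : ∀ {a} → Zigzag G a a 0
  via : ∀ {a m c b k} → adj G a m ≡ true → adj G c m ≡ true → Zigzag G c b k → Zigzag G a b (suc k)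

module _ {n} {G : Graph n} where

  midpoints : ∀ {a b k} → Zigzag G a b k → List (Fin n)
  midpoints [] = []
  midpoints (via {m = m} _ _ p) = m ∷ midpoints p

  data Halving (u v : Fin n) (k : ℕ) : Set where
    even : ∀ {s} → Zigzag G u v s → s + s ≡ k → Halving u v k
    odd  : ∀ {w s} → adj G u w ≡ true → Zigzag G w v s → suc (s + s) ≡ k → Halving u v k

  halve : ∀ {u v k} → Walk G u v k → Halving u v k
  halve here = even [] refl
  halve (step u→w p) with halve p
  ... | even q s+s≡k = odd u→w q (cong suc s+s≡k)
  ... | odd {s = s} w→x q 1+s+s≡k = even (via u→w (adj-sym G w→x) q) (cong suc (trans (+-suc s s) 1+s+s≡k))

  even-walk⇒zigzag : ∀ {u v k} → Walk G u v k → parity k ≡ 0ℙ → ∃ λ s → s + s ≡ k × Zigzag G u v s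
  even-walk⇒zigzag p even-k with halve p
  ... | even q s+s≡k = _ , s+s≡k , q
  ... | odd {s = s} _ _ refl with () ← trans (sym (parity[1+s+s]≡1ℙ s)) even-k

  record UniqueZigzag (a b : Fin n) (k : ℕ) : Set where
    constructor ⟨_,_,_⟩
    field
      {steps} : ℕ
      short   : steps ≤ k
      path    : Zigzag G a b steps
      unique  : Unique (midpoints path)

  -- Either m is not a midpoint of p, or the remainder of p after its midpoint m.
  skip-to : ∀ {c b k} (m : Fin n) (p : Zigzag G c b k) → Unique (midpoints p) →
            All (m ≢_) (midpoints p) ⊎
            ∃ λ f → adj G f m ≡ true ×
                    Σ (UniqueZigzag f b k) λ r → All (m ≢_) (midpoints (UniqueZigzag.path r))
  skip-to m [] _ = inj₁ []
  skip-to m (via {m = m'} _ c→m' p) (m'∉p ∷ unique) with m ≟ m' | skip-to m p unique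
  ... | yes refl | _ = inj₂ (_ , c→m' , ⟨ n≤1+n _ , p , unique ⟩ , m'∉p)
  ... | no m≢m' | inj₁ m∉p = inj₁ (m≢m' ∷ m∉p)
  ... | no _    | inj₂ (f , f→m , ⟨ j≤k , r , unique-r ⟩ , m∉r) =
    inj₂ (f , f→m , ⟨ m≤n⇒m≤1+n j≤k , r , unique-r ⟩ , m∉r)

  dedup : ∀ {a b k} → Zigzag G a b k → UniqueZigzag a b k
  dedup [] = ⟨ ≤-refl , [] , [] ⟩
  dedup (via {m = m} a→m c→m p) with dedup p
  ... | ⟨ j≤k , q , unique-q ⟩ with skip-to m q unique-q
  ...   | inj₁ m∉q = ⟨ s≤s j≤k , via a→m c→m q , m∉q ∷ unique-q ⟩
  ...   | inj₂ (f , f→m , ⟨ i≤j , r , unique-r ⟩ , m∉r) =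
    ⟨ s≤s (≤-trans i≤j j≤k) , via a→m f→m r , m∉r ∷ unique-r ⟩

  module _ (w : Fin n → Fin n → ℕ) where

    differences : ∀ {a b k} → Zigzag G a b k → List ℕ
    differences [] = []
    differences (via {a = a} {m = m} {c = c} _ _ p) = ∣ w a m - w c m ∣ ∷ differences p

    length-differences : ∀ {a b k} (p : Zigzag G a b k) → length (differences p) ≡ k
    length-differences [] = refl
    length-differences (via _ _ p) = cong suc (length-differences p)

    load-chain : (∀ {a v v'} → adj G a v ≡ true → adj G a v' ≡ true → w a v ≤ w a v' + 1) →
                 ∀ {a b k v₀ v₁} (p : Zigzag G a b k) → adj G a v₀ ≡ true → adj G b v₁ ≡ true →
                 w a v₀ ≤ w b v₁ + sum (differences p) + suc k
    load-chain balanced {a} {v₀ = v₀} {v₁} [] a→v₀ a→v₁ =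
      subst (λ z → w a v₀ ≤ z + 1) (sym (+-identityʳ (w a v₁))) (balanced a→v₀ a→v₁)
    load-chain balanced {a} {b} {suc k} {v₀} {v₁} (via {m = m} {c = c} a→m c→m p) a→v₀ b→v₁ = begin
      w a v₀                          ≤⟨ balanced a→v₀ a→m ⟩
      w a m + 1                       ≤⟨ +-monoˡ-≤ 1 (m≤n+∣m-n∣ (w a m) (w c m)) ⟩
      w c m + d + 1                   ≤⟨ +-monoˡ-≤ 1 (+-monoˡ-≤ d (load-chain balanced p c→m b→v₁)) ⟩
      w b v₁ + S + suc k + d + 1      ≡⟨ regroup (w b v₁) S k d ⟩
      w b v₁ + (d + S) + suc (suc k)  ∎
      where
      open ≤-Reasoning
      d = ∣ w a m - w c m ∣
      S = sum (differences p)
      regroup : ∀ x S k d → x + S + suc k + d + 1 ≡ x + (d + S) + suc (suc k)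
      regroup = solve-∀

    ∣difference∣²≤2*arrivalImbalance+1 : ∀ q {a c m} → adj G a m ≡ true → adj G c m ≡ true →
      ∣ w a m - w c m ∣ * ∣ w a m - w c m ∣ ≤ 2 * arrivalImbalance G w q m + 1
    ∣difference∣²≤2*arrivalImbalance+1 q {a} {c} {m} a→m c→m with a ≟ c
    ... | yes refl rewrite ∣n-n∣≡0 (w a m) = z≤n
    ... | no a≢c = ≤-trans (∣a-b∣²≤2[imbalance+imbalance]+1 (q m) (w a m) (w c m))
                           (+-monoˡ-≤ 1 (*-monoʳ-≤ 2 two-arrivals≤))
      where
      arrival : Fin n → ℕ
      arrival u = ind (adj G u m) * imbalance (q m) (w u m)
      two-arrivals≤ : imbalance (q m) (w a m) + imbalance (q m) (w c m) ≤ arrivalImbalance G w q m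
      two-arrivals≤ = subst₂ (λ x y → x + y ≤ arrivalImbalance G w q m) (ind-true a→m)
                             (trans (+-identityʳ (arrival c)) (ind-true c→m))
                             (sum-unique≤∑ arrival ((a≢c ∷ []) ∷ [] ∷ []))
        where
        ind-true : ∀ {b x} → b ≡ true → ind b * x ≡ x
        ind-true refl = +-identityʳ _

    sum-squared-differences≤ : ∀ q {a b k} (p : Zigzag G a b k) →
      sum (map (λ d → d * d) (differences p)) ≤ 2 * sum (map (arrivalImbalance G w q) (midpoints p)) + k
    sum-squared-differences≤ q [] = z≤n
    sum-squared-differences≤ q {k = suc k} (via {m = m} a→m c→m p) =
      ≤-trans (+-mono-≤ (∣difference∣²≤2*arrivalImbalance+1 q a→m c→m) (sum-squared-differences≤ q p))
              (≤-reflexive (regroup (arrivalImbalance G w q m) (sum (map (arrivalImbalance G w q) (midpoints p))) k))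
      where
      regroup : ∀ g s k → 2 * g + 1 + (2 * s + k) ≡ 2 * (g + s) + suc k
      regroup = solve-∀

    sum-differences²≤ : ∀ q {a b k} (p : Zigzag G a b k) → Unique (midpoints p) →
      sum (differences p) * sum (differences p) ≤ k * (2 * ∑ (arrivalImbalance G w q) + k)
    sum-differences²≤ q {k = k} p unique = begin
      sum ds * sum ds                                              ≤⟨ cauchy-schwarz ds ⟩
      length ds * sum (map (λ d → d * d) ds)
        ≡⟨ cong (_* sum (map (λ d → d * d) ds)) (length-differences p) ⟩
      k * sum (map (λ d → d * d) ds)
        ≤⟨ *-monoʳ-≤ k (sum-squared-differences≤ q p) ⟩
      k * (2 * sum (map (arrivalImbalance G w q) (midpoints p)) + k)
        ≤⟨ *-monoʳ-≤ k (+-monoˡ-≤ k (*-monoʳ-≤ 2 (sum-unique≤∑ (arrivalImbalance G w q) unique))) ⟩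
      k * (2 * ∑ (arrivalImbalance G w q) + k)                     ∎
      where
      open ≤-Reasoning
      ds = differences p

¬bipartite⇒monochromatic-edge : ∀ {n} (G : Graph n) → ¬ Bipartite G → (c : Fin n → Bool) →
                                ∃ λ a → ∃ λ b → adj G a b ≡ true × c a ≡ c b
¬bipartite⇒monochromatic-edge G non-bipartite c
  with any? (λ a → any? (λ b → (adj G a b B.≟ true) ×-dec (c a B.≟ c b)))
... | yes (a , b , a→b , same) = a , b , a→b , same
... | no no-edge = contradiction (c , λ u v u→v same → no-edge (u , v , u→v , same)) non-bipartite

module _ {n} {G : Graph n} {D : ℕ} (non-bipartite : ¬ Bipartite G)
         (walks : ∀ u v → ∃ λ k → k ≤ D × Walk G u v k) where

  private
    dist : Fin n → Fin n → ℕ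
    dist u v = proj₁ (walks u v)

    dist≤D : ∀ u v → dist u v ≤ D
    dist≤D u v = proj₁ (proj₂ (walks u v))

    walk : ∀ u v → Walk G u v (dist u v)
    walk u v = proj₂ (proj₂ (walks u v))

    same-colour⇒same-parity : ∀ p p' → does (p ≟ℙ 1ℙ) ≡ does (p' ≟ℙ 1ℙ) → p ≡ p'
    same-colour⇒same-parity 0ℙ 0ℙ _ = refl
    same-colour⇒same-parity 1ℙ 1ℙ _ = refl

  -- Colour vertices by the parity of their distance from u; a monochromatic edge a b closes an odd walk.
  odd-closed-walk : ∀ u → ∃ λ ℓ → ℓ ≤ D + suc D × parity ℓ ≡ 1ℙ × Walk G u u ℓ
  odd-closed-walk u with ¬bipartite⇒monochromatic-edge G non-bipartite (λ x → does (parity (dist u x) ≟ℙ 1ℙ))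
  ... | a , b , a→b , same-colour =
    dist u a + suc (dist u b) ,
    +-mono-≤ (dist≤D u a) (s≤s (dist≤D u b)) ,
    parity[i+1+j]≡1ℙ (dist u a) (dist u b) (same-colour⇒same-parity _ _ same-colour) ,
    walk-++ (walk u a) (step a→b (walk-reverse (walk u b)))

  short-zigzag : ∀ u v → ∃ λ s → s ≤ 2 * D × Zigzag G u v s
  short-zigzag u v with parity (dist u v) in parity-uv
  ... | 0ℙ with (s , s+s≡k , z) ← even-walk⇒zigzag (walk u v) parity-uv =
    s , ≤-trans (m≤m+n s s) (≤-trans (≤-reflexive s+s≡k) (≤-trans (dist≤D u v) (m≤n*m D 2))) , z
  ... | 1ℙ with (ℓ , ℓ≤2D+1 , odd-ℓ , cycle) ← odd-closed-walk u
      with (s , s+s≡ℓ+k , z) ← even-walk⇒zigzag (walk-++ cycle (walk u v))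
                                                (parity[i+j]≡0ℙ ℓ (dist u v) odd-ℓ parity-uv) =
    s , m+m≤1+n+n⇒m≤n s+s≤1+4D , z
    where
    regroup : ∀ D → D + suc D + D + D ≡ suc (2 * D + 2 * D)
    regroup = solve-∀
    s+s≤1+4D : s + s ≤ suc (2 * D + 2 * D)
    s+s≤1+4D = begin
      s + s             ≡⟨ s+s≡ℓ+k ⟩
      ℓ + dist u v      ≤⟨ +-mono-≤ ℓ≤2D+1 (dist≤D u v) ⟩
      D + suc D + D     ≤⟨ m≤m+n _ D ⟩
      D + suc D + D + D ≡⟨ regroup D ⟩
      suc (2 * D + 2 * D) ∎
      where open ≤-Reasoning

lemma6 : ∀ {n} (G : Graph n) (D : ℕ) (Wv : VertexLoads n) (We : ArcLoads n) →
         Connected G → ¬ Bipartite G → IsDiameter G D →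
         RoundFair G Wv We →
         ∀ t x → ArcDiscrepancy G We t x → 4 * D + 1 < x →
         4 * D * Φ G We (suc t) + (x ∸ (4 * D + 1)) * (x ∸ 1) ≤ 4 * D * Φ G We t
lemma6 G D Wv We _ non-bipartite (walks , _) rf t x (_ , u₀ , v₀ , u₁ , v₁ , u₀→v₀ , u₁→v₁ , max≡min+x) 4D+1<x =
  begin
  4 * D * Φ G We (suc t) + (x ∸ (4 * D + 1)) * (x ∸ 1)
    ≤⟨ +-monoʳ-≤ (4 * D * Φ G We (suc t))
         (potential-drop-bound D Y Δ k≤2D 4D+1<x x≤Y+1+k (sum-differences²≤ (We t) q p unique)) ⟩
  4 * D * Φ G We (suc t) + 4 * D * Δ ≡⟨ *-distribˡ-+ (4 * D) (Φ G We (suc t)) Δ ⟨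
  4 * D * (Φ G We (suc t) + Δ)       ≡⟨ cong (4 * D *_) (Φ-step rf t) ⟨
  4 * D * Φ G We t                   ∎
  where
  open ≤-Reasoning
  q = fairShare G Wv (suc t)
  Δ = ∑ (arrivalImbalance G (We t) q)
  shortest = short-zigzag non-bipartite walks u₀ u₁
  open UniqueZigzag (dedup (proj₂ (proj₂ shortest))) renaming (steps to k; path to p)
  Y = sum (differences (We t) p)
  k≤2D : k ≤ 2 * D
  k≤2D = ≤-trans short (proj₁ (proj₂ shortest))
  x≤Y+1+k : x ≤ Y + suc k
  x≤Y+1+k = +-cancelˡ-≤ (We t u₁ v₁) x (Y + suc k) (begin
    We t u₁ v₁ + x         ≡⟨ max≡min+x ⟨
    We t u₀ v₀             ≤⟨ load-chain (We t) (sent-loads-balanced rf t) p u₀→v₀ u₁→v₁ ⟩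
    We t u₁ v₁ + Y + suc k ≡⟨ +-assoc (We t u₁ v₁) Y (suc k) ⟩
    We t u₁ v₁ + (Y + suc k) ∎)
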